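{- For all positive integers $m,n$ there exists a $(2mn,n)$-filling family of subsets of $\mathbb{Z}^{2mn}$.
   Context: $[k]=\{1,\dots,k\}$. $\mathbb{Z}^d$ is the graph with edges $\{x,x+e_i\}$; $\Gamma(x)=\{x\pm e_i:i\in[d]\}$. For $M$ a multiple of $n$, a family $\{X^i_j\}_{i\in[\frac{M+n}{n}],j\in[2n]}$ of subsets of $\mathbb{Z}^M$, with $X^i=\bigsqcup_j X^i_j$, is $(M,n)$-filling if the family partitions $\mathbb{Z}^M$ and for each $i\in[\frac{M+n}{n}]$, $j\in[2n]$: if $x\in\mathbb{Z}^M\setminus X^i$ then $|\Gamma(x)\cap X^i_j|=1$, and if $x\in X^i$ then $\Gamma(x)\cap X^i=\emptyset$. -}

module Defs where

open import Data.Nat using (ℕ; suc; _*_)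
open import Data.Integer using (ℤ; _+_; _-_; 1ℤ)
open import Data.Fin using (Fin; _≟_)
open import Data.Bool using (Bool; true; false)
open import Data.Product using (Σ; _×_; _,_; ∃)
open import Relation.Nullary using (¬_; yes; no)
open import Relation.Binary.PropositionalEquality using (_≡_)

Point : ℕ → Set
Point M = Fin M → ℤ

Subset : ℕ → Set₁
Subset M = Point M → Set

nbr : {M : ℕ} → Point M → Fin M → Bool → Point M
nbr x k s l with k ≟ l
... | yes _ = if s then x l + 1ℤ else x l - 1ℤ
  where open import Data.Bool using (if_then_else_)
... | no _ = x l

-- "exactly one" of the 2M neighbours x ± e_k (indexed by (k , sign)) lies in A.
-- Since the 2M neighbours are pairwise distinct points, this is |Γ(x) ∩ A| = 1.
ExactlyOneNbrIn : {M : ℕ} → Subset M → Point M → Set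
ExactlyOneNbrIn {M} A x =
  Σ (Fin M × Bool) λ { (k , s) →
    A (nbr x k s) × (∀ k' s' → A (nbr x k' s') → (k' , s') ≡ (k , s)) }

NoNbrIn : {M : ℕ} → Subset M → Point M → Set
NoNbrIn {M} A x = ∀ (k : Fin M) (s : Bool) → ¬ A (nbr x k s)

-- (M , n)-filling family with M = q * n, so (M+n)/n = q + 1.
-- X i j is the set X^i_j; X^i = ⋃_j X^i_j.
IsFilling : (q n : ℕ) → (Fin (suc q) → Fin (2 * n) → Subset (q * n)) → Set
IsFilling q n X =
  (∀ x → Σ (Fin (suc q) × Fin (2 * n)) λ { (i , j) →
      X i j x × (∀ i' j' → X i' j' x → (i' , j') ≡ (i , j)) })
  × (∀ (i : Fin (suc q)) (j : Fin (2 * n)) (x : Point (q * n)) →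
       (¬ Xi i x → ExactlyOneNbrIn (X i j) x)
       × (Xi i x → NoNbrIn (Xi i) x))
  where
    Xi : Fin (suc q) → Subset (q * n)
    Xi i x = ∃ λ j → X i j x

Filling : (q n : ℕ) → Set₁
Filling q n = Σ (Fin (suc q) → Fin (2 * n) → Subset (q * n)) (IsFilling q n)

-- Index the M coordinates by pairs (p , e) with p ≤ m and e < 2(n+1),
-- and give coordinate (p , e) the weights a = p + 1 and c = e.  Put x into
-- X^i_j when Σ a_k x_k ≡ i (mod 2m+3) and Σ c_k x_k ≡ j (mod 2n+2).  Stepping
-- from x to x ± e_k moves the two sums by ±(a_k , c_k), and these 2M signed
-- steps hit every class (α , β) with α ≢ 0 exactly once and never a class
-- with α ≡ 0, because ±1, …, ±(m+1) represent every nonzero residue modulo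
-- 2m+3 exactly once.  Those three facts are precisely the filling conditions.
module Submission where

open import Defs
open import Data.Nat using (ℕ; suc; _*_; _∸_)
import Data.Nat as ℕ
import Data.Nat.Properties as ℕ
open import Data.Integer using (ℤ; +_; -_; _+_; _-_; 0ℤ; 1ℤ; -1ℤ; ∣_∣)
  renaming (_*_ to _·_)
import Data.Integer.Properties as ℤ
open import Data.Integer.Divisibility.Signed using (_∣_; divides; ∣m⇒∣-m; ∣m∣n⇒∣m+n; ∣n⇒∣m*n; ∣⇒∣ᵤ)
open import Data.Integer.Tactic.RingSolver using (solve-∀)
import Data.Nat.Divisibility as ℕ
open import Data.Integer.DivMod using (_/_; _%_; n%d<d; a≡a%n+[a/n]*n)
open import Data.Fin using (Fin; toℕ; fromℕ<; _≟_; punchIn; cast; combine; remQuot)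
import Data.Fin.Properties as Fin
open import Data.Bool using (Bool; true; false)
open import Data.Product using (Σ; _×_; _,_; proj₁; proj₂; ∃; uncurry)
open import Relation.Nullary using (¬_; contradiction; yes; no)
open import Algebra.Properties.CommutativeMonoid.Sum ℤ.+-0-commutativeMonoid
  using (sum; sum-remove; sum-cong-≗)
open import Relation.Binary.PropositionalEquality
open import Function using (_∘_)

infix 4 _≈_[mod_]

record _≈_[mod_] (a b : ℤ) (K : ℕ) : Set where
  constructor congruent
  field divides-difference : + K ∣ a - b

private
  same-difference : ∀ u d t → (u + d) - t ≡ d - (t - u)
  same-difference = solve-∀

module _ {K : ℕ} where

  ≈-by-difference : ∀ {a b c d} → a - b ≡ c - d → a ≈ b [mod K ] → c ≈ d [mod K ]
  ≈-by-difference eq (congruent K∣a-b) = congruent (subst (+ K ∣_) eq K∣a-b)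

  ≈-reflexive : ∀ {a b} → a ≡ b → a ≈ b [mod K ]
  ≈-reflexive {a} refl = congruent (divides 0ℤ (trans (ℤ.+-inverseʳ a) (sym (ℤ.*-zeroˡ (+ K)))))

  ≈-sym : ∀ {a b} → a ≈ b [mod K ] → b ≈ a [mod K ]
  ≈-sym {a} {b} (congruent K∣a-b) = congruent (subst (+ K ∣_) (neg-difference a b) (∣m⇒∣-m K∣a-b))
    where
    neg-difference : ∀ a b → - (a - b) ≡ b - a
    neg-difference = solve-∀

  ≈-trans : ∀ {a b c} → a ≈ b [mod K ] → b ≈ c [mod K ] → a ≈ c [mod K ]
  ≈-trans {a} {b} {c} (congruent K∣a-b) (congruent K∣b-c) =
    congruent (subst (+ K ∣_) (telescope a b c) (∣m∣n⇒∣m+n K∣a-b K∣b-c))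
    where
    telescope : ∀ a b c → (a - b) + (b - c) ≡ a - c
    telescope = solve-∀

  ≈-*ˡ : ∀ c {a b} → a ≈ b [mod K ] → c · a ≈ c · b [mod K ]
  ≈-*ˡ c {a} {b} (congruent K∣a-b) = congruent (subst (+ K ∣_) (distrib c a b) (∣n⇒∣m*n c K∣a-b))
    where
    distrib : ∀ c a b → c · (a - b) ≡ c · a - c · b
    distrib = solve-∀

  ≈-substˡ : ∀ {u v t} → u ≡ v → u ≈ t [mod K ] → v ≈ t [mod K ]
  ≈-substˡ {t = t} = subst (_≈ t [mod K ])

  ≈-substʳ : ∀ {u v t} → u ≡ v → t ≈ u [mod K ] → t ≈ v [mod K ]
  ≈-substʳ {t = t} = subst (t ≈_[mod K ])

  ≈-shift : ∀ u {d t} → u + d ≈ t [mod K ] → d ≈ t - u [mod K ]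
  ≈-shift u {d} {t} = ≈-by-difference (same-difference u d t)

  ≈-unshift : ∀ u {d t} → d ≈ t - u [mod K ] → u + d ≈ t [mod K ]
  ≈-unshift u {d} {t} = ≈-by-difference (sym (same-difference u d t))

  ≈-complement : ∀ {r} → r ℕ.≤ K → - + (K ∸ r) ≈ + r [mod K ]
  ≈-complement {r} r≤K = congruent (divides -1ℤ (begin
    - + (K ∸ r) - + r        ≡⟨ negate-sum (+ (K ∸ r)) (+ r) ⟩
    -1ℤ · (+ (K ∸ r) + + r)  ≡⟨ cong (-1ℤ ·_) (ℤ.pos-+ (K ∸ r) r) ⟨
    -1ℤ · + (K ∸ r ℕ.+ r)    ≡⟨ cong (λ z → -1ℤ · + z) (ℕ.m∸n+n≡m r≤K) ⟩
    -1ℤ · + K                ∎))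
    where
    open ≡-Reasoning
    negate-sum : ∀ a b → - a - b ≡ -1ℤ · (a + b)
    negate-sum = solve-∀

  ≈-below⇒≡ : ∀ {i j} → i ℕ.< K → j ℕ.< K → + i ≈ + j [mod K ] → i ≡ j
  ≈-below⇒≡ {i} {j} i<K j<K i≈j with ∣ + i - + j ∣ in dist | ∣⇒∣ᵤ (_≈_[mod_].divides-difference i≈j)
  ... | ℕ.zero | _   = ℤ.+-injective (ℤ.i-j≡0⇒i≡j (+ i) (+ j) (ℤ.∣i∣≡0⇒i≡0 dist))
  ... | suc d  | K∣d = contradiction K∣d (ℕ.>⇒∤ (ℕ.≤-trans (ℕ.s≤s ∣i-j∣≤max) (ℕ.⊔-lub i<K j<K)))
    where
    ∣i-j∣≤max : suc d ℕ.≤ i ℕ.⊔ j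
    ∣i-j∣≤max = subst (ℕ._≤ i ℕ.⊔ j) (trans (cong ∣_∣ (sym (ℤ.[+m]-[+n]≡m⊖n i j))) dist)
                      (ℤ.∣m⊝n∣≤m⊔n i j)

residue : ∀ K .{{_ : ℕ.NonZero K}} (z : ℤ) → Σ (Fin K) λ i → z ≈ + toℕ i [mod K ]
residue K z = fromℕ< r<K , congruent (divides (z / + K) (begin
    z - + toℕ (fromℕ< r<K)      ≡⟨ cong (λ r → z - + r) (Fin.toℕ-fromℕ< r<K) ⟩
    z - + r                     ≡⟨ cong (_- + r) (a≡a%n+[a/n]*n z (+ K)) ⟩
    (+ r + (z / + K) · + K) - + r ≡⟨ cancel (+ r) ((z / + K) · + K) ⟩
    (z / + K) · + K             ∎))
  where
  open ≡-Reasoning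
  r : ℕ
  r = z % + K
  r<K : r ℕ.< K
  r<K = n%d<d z (+ K)
  cancel : ∀ a b → (a + b) - a ≡ b
  cancel = solve-∀

residue-unique : ∀ {K} (i j : Fin K) → + toℕ i ≈ + toℕ j [mod K ] → i ≡ j
residue-unique i j i≈j = Fin.toℕ-injective (≈-below⇒≡ (Fin.toℕ<n i) (Fin.toℕ<n j) i≈j)

infix 9 ±_

±_ : Bool → ℤ
± true  = 1ℤ
± false = -1ℤ

±-involutive : ∀ s z → ± s · (± s · z) ≡ z
±-involutive true  z = trans (ℤ.*-identityˡ _) (ℤ.*-identityˡ z)
±-involutive false z = trans (ℤ.-1*i≡-i _) (trans (cong -_ (ℤ.-1*i≡-i z)) (ℤ.neg-involutive z))

±-transpose : ∀ {K} s {a b} → ± s · a ≈ b [mod K ] → a ≈ ± s · b [mod K ]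
±-transpose s {a} h = ≈-substˡ (±-involutive s a) (≈-*ˡ (± s) h)

±-cancel : ∀ {K} s {a b} → ± s · a ≈ ± s · b [mod K ] → a ≈ b [mod K ]
±-cancel s {b = b} h = ≈-substʳ (±-involutive s b) (±-transpose s h)

nbr-self : ∀ {M} (x : Point M) k s → nbr x k s k ≡ x k + ± s
nbr-self x k s with k ≟ k
nbr-self x k true  | yes _ = refl
nbr-self x k false | yes _ = refl
... | no k≢k = contradiction refl k≢k

nbr-other : ∀ {M} (x : Point M) k s l → k ≢ l → nbr x k s l ≡ x l
nbr-other x k s l k≢l with k ≟ l
... | yes k≡l = contradiction k≡l k≢l
... | no _    = refl

-- The linear form x ↦ Σ_l w_l x_l on ℤ^M.  It is kept opaque: only its
-- behaviour under steps to neighbours (⟨⟩-nbr) is used afterwards.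
opaque
  ⟨_,_⟩ : ∀ {M} → (Fin M → ℤ) → Point M → ℤ
  ⟨ w , x ⟩ = sum (λ l → w l · x l)

  ⟨⟩-nbr : ∀ {M} (w : Fin M → ℤ) (x : Point M) k s → ⟨ w , nbr x k s ⟩ ≡ ⟨ w , x ⟩ + ± s · w k
  ⟨⟩-nbr {suc M} w x k s = begin
    ⟨ w , nbr x k s ⟩                                  ≡⟨ sum-remove {i = k} (λ l → w l · nbr x k s l) ⟩
    w k · nbr x k s k + sum (λ l → w (punchIn k l) · nbr x k s (punchIn k l))
      ≡⟨ cong₂ (λ y r → w k · y + r) (nbr-self x k s) (sum-cong-≗ unchanged) ⟩
    w k · (x k + ± s) + rest                           ≡⟨ regroup (w k) (x k) (± s) rest ⟩
    (w k · x k + rest) + ± s · w k                     ≡⟨ cong (_+ ± s · w k) (sum-remove {i = k} (λ l → w l · x l)) ⟨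
    ⟨ w , x ⟩ + ± s · w k                              ∎
    where
    open ≡-Reasoning
    rest : ℤ
    rest = sum (λ l → w (punchIn k l) · x (punchIn k l))
    unchanged : ∀ l → w (punchIn k l) · nbr x k s (punchIn k l) ≡ w (punchIn k l) · x (punchIn k l)
    unchanged l = cong (w (punchIn k l) ·_) (nbr-other x k s (punchIn k l) (Fin.punchInᵢ≢i k l ∘ sym))
    regroup : ∀ a b σ r → a · (b + σ) + r ≡ (a · b + r) + σ · a
    regroup = solve-∀

record PerfectSteps {M : ℕ} (K₁ K₂ : ℕ) (a c : Fin M → ℤ) : Set where
  field
    step-nonzero   : ∀ k s → ¬ (± s · a k ≈ 0ℤ [mod K₁ ])
    step-onto      : ∀ α β → ¬ (α ≈ 0ℤ [mod K₁ ]) →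
                     Σ (Fin M × Bool) λ (k , s) → (± s · a k ≈ α [mod K₁ ]) × (± s · c k ≈ β [mod K₂ ])
    step-injective : ∀ {k s k′ s′} → ± s · a k ≈ ± s′ · a k′ [mod K₁ ] →
                     ± s · c k ≈ ± s′ · c k′ [mod K₂ ] → (k , s) ≡ (k′ , s′)

-- A neighbour of x lies in
-- X^i_j exactly when its step moves (⟨a , x⟩ , ⟨c , x⟩) onto (i , j), so the
-- filling conditions are the three properties of perfect steps.
module PerfectStepFilling (q n : ℕ) (a c : Fin (q * suc n) → ℤ)
                          (perfect : PerfectSteps (suc q) (2 * suc n) a c) where
  open PerfectSteps perfect

  M : ℕ
  M = q * suc n

  X : Fin (suc q) → Fin (2 * suc n) → Subset M
  X i j x = (⟨ a , x ⟩ ≈ + toℕ i [mod suc q ]) × (⟨ c , x ⟩ ≈ + toℕ j [mod 2 * suc n ])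

  -- The step a neighbour must make to land in X^i_j.
  Δa : Fin (suc q) → Point M → ℤ
  Δa i x = + toℕ i - ⟨ a , x ⟩

  Δc : Fin (2 * suc n) → Point M → ℤ
  Δc j x = + toℕ j - ⟨ c , x ⟩

  nbr∈X⇒step : ∀ {i j} x k s → X i j (nbr x k s) →
               (± s · a k ≈ Δa i x [mod suc q ]) × (± s · c k ≈ Δc j x [mod 2 * suc n ])
  nbr∈X⇒step x k s (ax≈i , cx≈j) =
    ≈-shift ⟨ a , x ⟩ (≈-substˡ (⟨⟩-nbr a x k s) ax≈i) ,
    ≈-shift ⟨ c , x ⟩ (≈-substˡ (⟨⟩-nbr c x k s) cx≈j)

  step⇒nbr∈X : ∀ {i j} x k s → ± s · a k ≈ Δa i x [mod suc q ] → ± s · c k ≈ Δc j x [mod 2 * suc n ] →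
               X i j (nbr x k s)
  step⇒nbr∈X x k s a-step c-step =
    ≈-substˡ (sym (⟨⟩-nbr a x k s)) (≈-unshift ⟨ a , x ⟩ a-step) ,
    ≈-substˡ (sym (⟨⟩-nbr c x k s)) (≈-unshift ⟨ c , x ⟩ c-step)

  Δa≈0⇒a-class : ∀ {i} x → Δa i x ≈ 0ℤ [mod suc q ] → ⟨ a , x ⟩ ≈ + toℕ i [mod suc q ]
  Δa≈0⇒a-class x h = ≈-substˡ (ℤ.+-identityʳ ⟨ a , x ⟩) (≈-unshift ⟨ a , x ⟩ (≈-sym h))

  a-class⇒Δa≈0 : ∀ {i} x → ⟨ a , x ⟩ ≈ + toℕ i [mod suc q ] → Δa i x ≈ 0ℤ [mod suc q ]
  a-class⇒Δa≈0 x h = ≈-sym (≈-shift ⟨ a , x ⟩ (≈-substˡ (sym (ℤ.+-identityʳ ⟨ a , x ⟩)) h))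

  partition : ∀ x → Σ (Fin (suc q) × Fin (2 * suc n)) λ { (i , j) →
                X i j x × (∀ i′ j′ → X i′ j′ x → (i′ , j′) ≡ (i , j)) }
  partition x with residue (suc q) ⟨ a , x ⟩ | residue (2 * suc n) ⟨ c , x ⟩
  ... | i , ax≈i | j , cx≈j = (i , j) , (ax≈i , cx≈j) , λ i′ j′ (ax≈i′ , cx≈j′) →
    cong₂ _,_ (residue-unique i′ i (≈-trans (≈-sym ax≈i′) ax≈i))
              (residue-unique j′ j (≈-trans (≈-sym cx≈j′) cx≈j))

  -- If x ∉ X^i, the neighbours of x in X^i_j are reached by the signed steps
  -- onto the nonzero target (Δa i x , Δc j x), and there is exactly one.
  exactly-one : ∀ i j x → ¬ (∃ λ j′ → X i j′ x) → ExactlyOneNbrIn (X i j) x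
  exactly-one i j x x∉Xi with step-onto (Δa i x) (Δc j x) Δa≉0
    where
    Δa≉0 : ¬ (Δa i x ≈ 0ℤ [mod suc q ])
    Δa≉0 Δa≈0 with residue (2 * suc n) ⟨ c , x ⟩
    ... | j′ , cx≈j′ = x∉Xi (j′ , Δa≈0⇒a-class x Δa≈0 , cx≈j′)
  ... | (k , s) , a-step , c-step = (k , s) , step⇒nbr∈X x k s a-step c-step , unique
    where
    unique : ∀ k′ s′ → X i j (nbr x k′ s′) → (k′ , s′) ≡ (k , s)
    unique k′ s′ into with nbr∈X⇒step x k′ s′ into
    ... | a-step′ , c-step′ = step-injective (≈-trans a-step′ (≈-sym a-step)) (≈-trans c-step′ (≈-sym c-step))

  -- No neighbour of a point of X^i lies in X^i: its step would vanish in the first coordinate.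
  no-nbr : ∀ i x → ∃ (λ j → X i j x) → NoNbrIn (λ y → ∃ λ j → X i j y) x
  no-nbr i x (_ , ax≈i , _) k s (_ , into) =
    step-nonzero k s (≈-trans (proj₁ (nbr∈X⇒step x k s into)) (a-class⇒Δa≈0 x ax≈i))

  filling : Filling q (suc n)
  filling = X , partition , λ i j x → exactly-one i j x , no-nbr i x

module SignedHalfSystem (m : ℕ) where

  K : ℕ
  K = suc (2 * suc m)

  half : Fin (suc m) → ℤ
  half p = + suc (toℕ p)

  half<K : ∀ p → suc (toℕ p) ℕ.< K
  half<K p = ℕ.s≤s (ℕ.≤-trans (Fin.toℕ<n p) (ℕ.m≤m+n (suc m) (suc m ℕ.+ 0)))

  half-nonzero : ∀ s p → ¬ (± s · half p ≈ 0ℤ [mod K ])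
  half-nonzero s p h =
    ℕ.1+n≢0 (≈-below⇒≡ (half<K p) (ℕ.s≤s ℕ.z≤n) (±-cancel s (≈-substʳ (sym (ℤ.*-zeroʳ (± s))) h)))

  same-sign : ∀ s {p p′} → ± s · half p ≈ ± s · half p′ [mod K ] → p ≡ p′
  same-sign s {p} {p′} h =
    Fin.toℕ-injective (ℕ.suc-injective (≈-below⇒≡ (half<K p) (half<K p′) (±-cancel s h)))

  half≉-half : ∀ p p′ → ¬ (± true · half p ≈ ± false · half p′ [mod K ])
  half≉-half p p′ h = ℕ.1+n≢0 (≈-below⇒≡ sum<K (ℕ.s≤s ℕ.z≤n) (≈-by-difference to-sum h))
    where
    h₁ h₂ : ℕ
    h₁ = suc (toℕ p)
    h₂ = suc (toℕ p′)
    sum<K : h₁ ℕ.+ h₂ ℕ.< K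
    sum<K = ℕ.s≤s (ℕ.+-mono-≤ (Fin.toℕ<n p) (ℕ.≤-trans (Fin.toℕ<n p′) (ℕ.m≤m+n (suc m) 0)))
    to-sum : 1ℤ · + h₁ - -1ℤ · + h₂ ≡ + (h₁ ℕ.+ h₂) - 0ℤ
    to-sum = trans (signed-sum (+ h₁) (+ h₂)) (cong (_- 0ℤ) (sym (ℤ.pos-+ h₁ h₂)))
      where
      signed-sum : ∀ a b → 1ℤ · a - -1ℤ · b ≡ (a + b) - 0ℤ
      signed-sum = solve-∀

  half-injective : ∀ {s p s′ p′} → ± s · half p ≈ ± s′ · half p′ [mod K ] → (s , p) ≡ (s′ , p′)
  half-injective {true}  {p} {true}  {p′} h = cong (true ,_)  (same-sign true h)
  half-injective {false} {p} {false} {p′} h = cong (false ,_) (same-sign false h)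
  half-injective {true}  {p} {false} {p′} h = contradiction h (half≉-half p p′)
  half-injective {false} {p} {true}  {p′} h = contradiction (≈-sym h) (half≉-half p′ p)

  complement-half : ∀ r → r ℕ.< K → suc m ℕ.< r → Σ (Fin (suc m)) λ p → half p ≡ + (K ∸ r)
  complement-half r r<K m<r with K ∸ r | ℕ.m<n⇒0<n∸m r<K | complement≤m
    where
    complement≤m : K ∸ r ℕ.≤ suc m
    complement≤m = ℕ.≤-trans (ℕ.∸-monoʳ-≤ K m<r)
                     (ℕ.≤-reflexive (trans (ℕ.m+n∸m≡n (suc m) (suc m ℕ.+ 0)) (ℕ.+-identityʳ (suc m))))
  ... | suc d | _ | d<m = fromℕ< d<m , cong (λ t → + suc t) (Fin.toℕ-fromℕ< d<m)

  half-represents : ∀ r → r ℕ.< K → r ≢ 0 → Σ (Bool × Fin (suc m)) λ (s , p) → ± s · half p ≈ + r [mod K ]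
  half-represents ℕ.zero    _   r≢0 = contradiction refl r≢0
  half-represents (suc r′) r<K _ with suc r′ ℕ.≤? suc m
  ... | yes r≤m = (true , fromℕ< r≤m) ,
                  ≈-reflexive (trans (ℤ.*-identityˡ _) (cong (λ t → + suc t) (Fin.toℕ-fromℕ< r≤m)))
  ... | no  r≰m with complement-half (suc r′) r<K (ℕ.≰⇒> r≰m)
  ...   | p , half≡ = (false , p) ,
          ≈-substˡ (sym (trans (ℤ.-1*i≡-i (half p)) (cong -_ half≡))) (≈-complement (ℕ.<⇒≤ r<K))

  half-onto : ∀ α → ¬ (α ≈ 0ℤ [mod K ]) → Σ (Bool × Fin (suc m)) λ (s , p) → ± s · half p ≈ α [mod K ]
  half-onto α α≉0 with residue K α
  ... | r , α≈r with half-represents (toℕ r) (Fin.toℕ<n r) r≢0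
    where
    r≢0 : toℕ r ≢ 0
    r≢0 r≡0 = α≉0 (≈-substʳ (cong +_ r≡0) α≈r)
  ... | sp , represents = sp , ≈-trans represents (≈-sym α≈r)

module Weights (m n : ℕ) where
  open SignedHalfSystem m

  M : ℕ
  M = 2 * suc m * suc n

  shape : M ≡ suc m * (2 * suc n)
  shape = trans (cong (ℕ._* suc n) (ℕ.*-comm 2 (suc m))) (ℕ.*-assoc (suc m) 2 (suc n))

  decode : Fin M → Fin (suc m) × Fin (2 * suc n)
  decode k = remQuot (2 * suc n) (cast shape k)

  encode : Fin (suc m) → Fin (2 * suc n) → Fin M
  encode p e = cast (sym shape) (combine p e)

  decode-encode : ∀ p e → decode (encode p e) ≡ (p , e)
  decode-encode p e = begin
    remQuot (2 * suc n) (cast shape (cast (sym shape) (combine p e)))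
      ≡⟨ cong (remQuot (2 * suc n)) (Fin.cast-involutive shape (sym shape) (combine p e)) ⟩
    remQuot (2 * suc n) (combine p e)
      ≡⟨ Fin.remQuot-combine p e ⟩
    (p , e)
      ∎
    where open ≡-Reasoning

  decode-injective : ∀ {k k′} → decode k ≡ decode k′ → k ≡ k′
  decode-injective {k} {k′} eq = Fin.toℕ-injective (begin
    toℕ k                                         ≡⟨ Fin.toℕ-cast shape k ⟨
    toℕ (cast shape k)                            ≡⟨ cong toℕ (Fin.combine-remQuot {suc m} (2 * suc n) (cast shape k)) ⟨
    toℕ (uncurry combine (decode k))              ≡⟨ cong (toℕ ∘ uncurry combine) eq ⟩
    toℕ (uncurry combine (decode k′))             ≡⟨ cong toℕ (Fin.combine-remQuot {suc m} (2 * suc n) (cast shape k′)) ⟩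
    toℕ (cast shape k′)                           ≡⟨ Fin.toℕ-cast shape k′ ⟩
    toℕ k′                                        ∎)
    where open ≡-Reasoning

  a c : Fin M → ℤ
  a k = half (proj₁ (decode k))
  c k = + toℕ (proj₂ (decode k))

  -- The signed steps are perfect: the first coordinate runs once through
  -- the signed half system, and for each sign the second through all of
  -- ℤ/2(n+1).
  perfect : PerfectSteps K (2 * suc n) a c
  perfect = record
    { step-nonzero   = λ k s → half-nonzero s (proj₁ (decode k))
    ; step-onto      = onto
    ; step-injective = injective
    }
    where
    onto : ∀ α β → ¬ (α ≈ 0ℤ [mod K ]) →
           Σ (Fin M × Bool) λ (k , s) → (± s · a k ≈ α [mod K ]) × (± s · c k ≈ β [mod 2 * suc n ])
    onto α β α≉0 =
      let (s , p) , a-step = half-onto α α≉0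
          e , sβ≈e          = residue (2 * suc n) (± s · β)
          coordinates       = sym (decode-encode p e)
      in (encode p e , s) ,
         ≈-substˡ (cong (λ pe → ± s · half (proj₁ pe)) coordinates) a-step ,
         ≈-substˡ (cong (λ pe → ± s · + toℕ (proj₂ pe)) coordinates) (≈-sym (±-transpose s sβ≈e))

    injective : ∀ {k s k′ s′} → ± s · a k ≈ ± s′ · a k′ [mod K ] →
                ± s · c k ≈ ± s′ · c k′ [mod 2 * suc n ] → (k , s) ≡ (k′ , s′)
    injective {k} {s} {k′} {s′} a≈ c≈ = cong₂ _,_ (decode-injective (cong₂ _,_ p≡p′ e≡e′)) s≡s′
      where
      same-half : (s , proj₁ (decode k)) ≡ (s′ , proj₁ (decode k′))
      same-half = half-injective a≈
      s≡s′ : s ≡ s′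
      s≡s′ = cong proj₁ same-half
      p≡p′ : proj₁ (decode k) ≡ proj₁ (decode k′)
      p≡p′ = cong proj₂ same-half
      e≡e′ : proj₂ (decode k) ≡ proj₂ (decode k′)
      e≡e′ = residue-unique _ _ (±-cancel s (≈-substʳ (cong (λ t → ± t · c k′) (sym s≡s′)) c≈))

lemma3p4 : (m n : ℕ) → Filling (2 * suc m) (suc n)
lemma3p4 m n = PerfectStepFilling.filling (2 * suc m) n a c perfect
  where open Weights m n
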